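{- Let $p$ be a prime and let $\mathcal{E}$ be a finite family of linear equations over $\mathbb{F}_p$ as described in the context. Then $\mathcal{T}(\mathcal{E}) \ge |\mathcal{E}|^{1/2}$.
   Context: A family $\mathcal{E}$ consists of $n=|\mathcal{E}|$ equations $a_j x + b_j y + c_j z = d_j$ ($j=1,\dots,n$) with $a_j,b_j,c_j \in \mathbb{F}_p^*=\mathbb{F}_p\setminus\{0\}$, $d_j\in\mathbb{F}_p$, such that no two coefficient triples $(a_j,b_j,c_j)$, $(a_i,b_i,c_i)$, $i\ne j$, are proportional (so the triples define $n$ distinct points of the projective plane). For $k\in\{1,2,3\}$, divide each triple $(a_j,b_j,c_j)$ by its $k$-th coordinate and record the remaining two coordinates as a point $(u^{(k)}_j,v^{(k)}_j)\in(\mathbb{F}_p^*)^2$ (i.e. intersect with the plane where the $k$-th coordinate equals $1$); these $n$ points are distinct. Let $\mathcal{T}_k(\mathcal{E})$ be the maximal size of a set $J\subseteq\{1,\dots,n\}$ such that the first coordinates $u^{(k)}_j$, $j\in J$, are pairwise distinct and the second coordinates $v^{(k)}_j$, $j\in J$, are pairwise distinct. Define $\mathcal{T}(\mathcal{E})=\max_{k}\mathcal{T}_k(\mathcal{E})$. -}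

module Defs where

open import Data.Nat using (ℕ; zero; suc; _*_; _∸_; _^_; NonZero)
open import Data.Nat.DivMod using (_mod_)
open import Data.Fin using (Fin; toℕ)
import Data.Fin as Fin
open import Data.Fin.Subset using (Subset; _∈_)
open import Data.Product using (_×_; _,_; ∃-syntax; proj₁; proj₂)
open import Relation.Nullary using (¬_)
open import Relation.Binary.PropositionalEquality using (_≡_; _≢_)

module Fp (p : ℕ) .{{_ : NonZero p}} where

  F : Set
  F = Fin p

  infixl 7 _·_
  _·_ : F → F → F
  x · y = (toℕ x * toℕ y) mod p

  NonZeroF : F → Set
  NonZeroF x = toℕ x ≢ 0

  -- multiplicative inverse in F_p (Fermat: x^(p-2); correct for p prime, x ≠ 0)
  inv : F → F
  inv x = (toℕ x ^ (p ∸ 2)) mod p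

  _÷_ : F → F → F
  x ÷ y = x · inv y

  Proportional : F × F × F → F × F × F → Set
  Proportional (a , b , c) (a' , b' , c') =
    ∃[ l ] (NonZeroF l × (a' ≡ l · a) × (b' ≡ l · b) × (c' ≡ l · c))

  -- Dehomogenisation w.r.t. the k-th coordinate (k = 0,1,2 stands for k = 1,2,3):
  -- divide by the k-th coordinate and keep the other two coordinates in order.
  project : Fin 3 → F × F × F → F × F
  project Fin.zero (a , b , c) = (b ÷ a , c ÷ a)
  project (Fin.suc Fin.zero) (a , b , c) = (a ÷ b , c ÷ b)
  project (Fin.suc (Fin.suc Fin.zero)) (a , b , c) = (a ÷ c , b ÷ c)

  -- A family of n equations a_j x + b_j y + c_j z = d_j over F_p.
  record Family (n : ℕ) : Set where
    field
      a b c d : Fin n → F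

    triple : Fin n → F × F × F
    triple j = (a j , b j , c j)

  record Admissible {n : ℕ} (E : Family n) : Set where
    open Family E
    field
      a-nz : ∀ j → NonZeroF (a j)
      b-nz : ∀ j → NonZeroF (b j)
      c-nz : ∀ j → NonZeroF (c j)
      nonprop : ∀ i j → i ≢ j → ¬ Proportional (triple i) (triple j)

  IsTransversal : {n : ℕ} → Family n → Fin 3 → Subset n → Set
  IsTransversal E k J =
    ∀ i j → i ∈ J → j ∈ J → i ≢ j →
      (proj₁ (project k (triple i)) ≢ proj₁ (project k (triple j))) ×
      (proj₂ (project k (triple i)) ≢ proj₂ (project k (triple j)))
    where open Family E

-- Dehomogenising by the first coefficient turns equation j into the point (b_j/a_j, c_j/a_j), i.e. into
-- an edge of the bipartite graph between the values of b/a and the values of c/a.  A matching of this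
-- graph is a transversal for k = 1.  A fibre (all points with the same b/a, resp. the same c/a) is a
-- transversal for k = 3, resp. k = 2: two non-proportional triples sharing one ratio differ in both
-- ratios of the other projection.  By Kőnig's theorem a maximum matching M comes with a vertex cover of
-- size |M|, so n ≤ |M| Δ where Δ is the largest fibre, and therefore n ≤ max(|M|, Δ)².  Since inverses in
-- F_p are defined as x^(p-2), the field arithmetic rests on Fermat's little theorem.
module Submission where

open import Defs
open import Data.Nat
open import Data.Nat.Properties
open import Data.Nat.DivMod
open import Data.Nat.Divisibility
open import Data.Nat.Primality
open import Data.Nat.Combinatorics using (_C_; nCn≡1; nCk≡n!/k![n-k]!; k![n∸k]!∣n!)
open import Data.Fin using (Fin; toℕ; fromℕ; inject₁) renaming (zero to fzero; suc to fsuc)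
import Data.Fin
open import Data.Fin.Properties using (toℕ<n; toℕ-fromℕ; toℕ-inject₁; toℕ-fromℕ<; toℕ-injective)
open import Data.Fin.Subset using (Subset; ⁅_⁆; _∪_; ⊥; ∣_∣) renaming (_∈_ to _∈ₛ_)
open import Data.Fin.Subset.Properties
  using (x∈p∪q⁻; x∈p∪q⁺; x∈⁅y⁆⇒x≡y; x∈⁅x⁆; ∉⊥; p⊂q⇒∣p∣<∣q∣; q⊆p∪q)
open import Data.List using (List; []; _∷_; length; filter; allFin)
open import Data.List.Properties using (filter-notAll; length-tabulate)
open import Data.List.Membership.Propositional using (_∈_; _∉_; find; lose)
open import Data.List.Membership.Propositional.Properties using (∈-filter⁺; ∈-filter⁻)
open import Data.List.Relation.Binary.Subset.Propositional using (_⊆_)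
import Data.List.Relation.Binary.Sublist.Propositional.Properties as Sublist
open import Data.List.Relation.Unary.Any using (Any; here; there; any?)
import Data.List.Relation.Unary.All as All
open import Data.List.Relation.Unary.AllPairs using (AllPairs; []; _∷_)
import Data.List.Relation.Unary.AllPairs as AllPairs
open import Data.List.Relation.Unary.Unique.Propositional using (Unique)
import Data.List.Relation.Unary.Unique.Propositional.Properties as Unique
open import Data.List.Extrema ≤-totalOrder using (argmax; f[xs]≤f[argmax])
open import Data.Product using (_×_; _,_; ∃-syntax; proj₁; proj₂)
open import Data.Sum using (_⊎_; inj₁; inj₂)
open import Data.Sum.Properties using (≡-dec)
open import Data.Vec.Functional using (Vector; init; last; tail)
open import Function using (_∘_; id)
open import Level using (0ℓ)
open import Relation.Nullary using (¬_; contradiction; Dec; yes; no; ¬?; _×-dec_)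
open import Relation.Unary using (Pred; Decidable)
open import Relation.Binary using (Rel; Symmetric)
open import Relation.Binary.Definitions using (DecidableEquality)
open import Relation.Binary.PropositionalEquality
open import Relation.Binary.PropositionalEquality.Algebra using (isMagma)
open import Algebra.Bundles using (CommutativeSemiring; CommutativeMonoid)
open import Algebra.Structures using (IsCommutativeMonoid)
import Algebra.Properties.CommutativeSemiring.Binomial as Binomial
import Algebra.Properties.Monoid.Sum as MonoidSum

-- The library's binomial theorem uses the semiring's _^_ and _×_, which are not definitionally those of ℕ.
module BinomialTheoremℕ where
  open CommutativeSemiring +-*-commutativeSemiring using (semiring; +-rawMonoid; +-monoid)
  open import Algebra.Properties.Semiring.Exp semiring using () renaming (_^_ to _^ₛ_)
  open import Algebra.Definitions.RawMonoid +-rawMonoid using () renaming (_×_ to _×ₛ_; sum to sumₛ) public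
  open MonoidSum +-monoid using (sum-init-last) public
  open Binomial +-*-commutativeSemiring using (binomialTerm) public

  ^ₛ≗^ : ∀ x n → x ^ₛ n ≡ x ^ n
  ^ₛ≗^ x zero    = refl
  ^ₛ≗^ x (suc n) = cong (x *_) (^ₛ≗^ x n)

  ×ₛ≗* : ∀ n y → n ×ₛ y ≡ n * y
  ×ₛ≗* zero    y = refl
  ×ₛ≗* (suc n) y = cong (y +_) (×ₛ≗* n y)

  theorem : ∀ n x y → (x + y) ^ n ≡ sumₛ (binomialTerm x y n)
  theorem n x y = trans (sym (^ₛ≗^ (x + y) n)) (Binomial.theorem +-*-commutativeSemiring n x y)

  binomialTerm≡ : ∀ x y n k → binomialTerm x y n k ≡ (n C toℕ k) * (x ^ toℕ k * y ^ (n ∸ toℕ k))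
  binomialTerm≡ x y n k =
    trans (×ₛ≗* (n C toℕ k) _) (cong₂ (λ a b → (n C toℕ k) * (a * b)) (^ₛ≗^ x (toℕ k)) (^ₛ≗^ y (n ∸ toℕ k)))

module _ {d : ℕ} .{{_ : NonZero d}} where
  open BinomialTheoremℕ

  %-cong-+ : ∀ {m m′ n n′} → m % d ≡ m′ % d → n % d ≡ n′ % d → (m + n) % d ≡ (m′ + n′) % d
  %-cong-+ {m} {m′} {n} {n′} m≡m′ n≡n′ = begin
    (m + n) % d             ≡⟨ %-distribˡ-+ m n d ⟩
    (m % d + n % d) % d     ≡⟨ cong₂ (λ a b → (a + b) % d) m≡m′ n≡n′ ⟩
    (m′ % d + n′ % d) % d   ≡⟨ %-distribˡ-+ m′ n′ d ⟨
    (m′ + n′) % d           ∎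
    where open ≡-Reasoning

  %-cong-* : ∀ {m m′ n n′} → m % d ≡ m′ % d → n % d ≡ n′ % d → (m * n) % d ≡ (m′ * n′) % d
  %-cong-* {m} {m′} {n} {n′} m≡m′ n≡n′ = begin
    (m * n) % d             ≡⟨ %-distribˡ-* m n d ⟩
    (m % d * (n % d)) % d   ≡⟨ cong₂ (λ a b → (a * b) % d) m≡m′ n≡n′ ⟩
    (m′ % d * (n′ % d)) % d ≡⟨ %-distribˡ-* m′ n′ d ⟨
    (m′ * n′) % d           ∎
    where open ≡-Reasoning

  %≡%⇒∣∸ : ∀ {m n} → n ≤ m → m % d ≡ n % d → d ∣ m ∸ n
  %≡%⇒∣∸ {m} {n} n≤m m≡n = divides (m / d ∸ n / d) (begin
    m ∸ n                                     ≡⟨ cong₂ _∸_ (m≡m%n+[m/n]*n m d) (m≡m%n+[m/n]*n n d) ⟩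
    (m % d + m / d * d) ∸ (n % d + n / d * d) ≡⟨ cong (λ r → (r + m / d * d) ∸ (n % d + n / d * d)) m≡n ⟩
    (n % d + m / d * d) ∸ (n % d + n / d * d) ≡⟨ [m+n]∸[m+o]≡n∸o (n % d) (m / d * d) (n / d * d) ⟩
    m / d * d ∸ n / d * d                     ≡⟨ *-distribʳ-∸ d (m / d) (n / d) ⟨
    (m / d ∸ n / d) * d                       ∎)
    where open ≡-Reasoning

  ∣∸⇒%≡% : ∀ {m n} → n ≤ m → d ∣ m ∸ n → m % d ≡ n % d
  ∣∸⇒%≡% {m} {n} n≤m d∣m∸n = trans (cong (_% d) (sym (m∸n+n≡m n≤m))) (%-remove-+ˡ n d∣m∸n)

  ∣-sumₛ : ∀ {m} (v : Vector ℕ m) → (∀ i → d ∣ v i) → d ∣ sumₛ v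
  ∣-sumₛ {zero}  v d∣v = d ∣0
  ∣-sumₛ {suc m} v d∣v = ∣m∣n⇒∣m+n (d∣v fzero) (∣-sumₛ (tail v) (d∣v ∘ fsuc))

  [x+y]^n%d≡[x^n+y^n]%d : ∀ n .{{_ : NonZero n}} x y → (∀ {k} → 0 < k → k < n → d ∣ n C k) →
                          (x + y) ^ n % d ≡ (x ^ n + y ^ n) % d
  [x+y]^n%d≡[x^n+y^n]%d n@(suc q) x y d∣nCk = begin
    (x + y) ^ n % d                                ≡⟨ cong (_% d) expand ⟩
    (T fzero + (sumₛ middle + last (tail T))) % d  ≡⟨ cong (_% d) (rearrange (T fzero) (sumₛ middle) _) ⟩
    (sumₛ middle + (last (tail T) + T fzero)) % d  ≡⟨ %-remove-+ˡ _ (∣-sumₛ middle d∣middle) ⟩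
    (last (tail T) + T fzero) % d                  ≡⟨ cong₂ (λ a b → (a + b) % d) T-last T-first ⟩
    (x ^ n + y ^ n) % d                            ∎
    where
    open ≡-Reasoning
    T : Vector ℕ (suc n)
    T = binomialTerm x y n
    middle : Vector ℕ q
    middle = init (tail T)
    expand : (x + y) ^ n ≡ T fzero + (sumₛ middle + last (tail T))
    expand = trans (theorem n x y) (cong (T fzero +_) (sum-init-last (tail T)))
    rearrange : ∀ a b c → a + (b + c) ≡ b + (c + a)
    rearrange a b c = trans (+-comm a (b + c)) (+-assoc b c a)
    T-first : T fzero ≡ y ^ n
    T-first = trans (binomialTerm≡ x y n fzero) (trans (*-identityˡ _) (*-identityˡ _))
    T-last : last (tail T) ≡ x ^ n
    T-last = begin
      last (tail T)
        ≡⟨ binomialTerm≡ x y n (fromℕ n) ⟩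
      (n C toℕ (fromℕ n)) * (x ^ toℕ (fromℕ n) * y ^ (n ∸ toℕ (fromℕ n)))
        ≡⟨ cong (λ k → (n C k) * (x ^ k * y ^ (n ∸ k))) (toℕ-fromℕ n) ⟩
      (n C n) * (x ^ n * y ^ (n ∸ n))
        ≡⟨ cong₂ (λ a b → a * (x ^ n * y ^ b)) (nCn≡1 n) (n∸n≡0 n) ⟩
      1 * (x ^ n * 1)
        ≡⟨ trans (*-identityˡ _) (*-identityʳ _) ⟩
      x ^ n
        ∎
    d∣middle : ∀ i → d ∣ middle i
    d∣middle i = subst (d ∣_) (sym (binomialTerm≡ x y n (fsuc (inject₁ i))))
      (∣m⇒∣m*n _ (d∣nCk (s≤s z≤n) (s≤s (subst (_< q) (sym (toℕ-inject₁ i)) (toℕ<n i)))))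

n∣n! : ∀ n → .{{NonZero n}} → n ∣ n !
n∣n! (suc n) = m∣m*n (n !)

nCk*k!*[n∸k]!≡n! : ∀ {n k} → k ≤ n → (n C k) * (k ! * (n ∸ k) !) ≡ n !
nCk*k!*[n∸k]!≡n! {n} {k} k≤n =
  trans (cong (_* (k ! * (n ∸ k) !)) (nCk≡n!/k![n-k]! k≤n)) (m/n*n≡m (k![n∸k]!∣n! k≤n))
  where instance _ = k !* (n ∸ k) !≢0

module Fermat {p : ℕ} (p-prime : Prime p) where
  instance
    p-nonZero : NonZero p
    p-nonZero = prime⇒nonZero p-prime

  1<p : 1 < p
  1<p = nonTrivial⇒n>1 p {{prime⇒nonTrivial p-prime}}

  p∤m! : ∀ m → m < p → p ∤ m !
  p∤m! zero    _   = >⇒∤ 1<p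
  p∤m! (suc m) m<p p∣ with euclidsLemma (suc m) (m !) p-prime p∣
  ... | inj₁ p∣1+m = >⇒∤ m<p p∣1+m
  ... | inj₂ p∣m!  = p∤m! m (<-trans (n<1+n m) m<p) p∣m!

  p∣pCk : ∀ {k} → 0 < k → k < p → p ∣ p C k
  p∣pCk {k} 0<k k<p with euclidsLemma (p C k) (k ! * (p ∸ k) !) p-prime p∣pCk*k!*[p∸k]!
    where
    p∣pCk*k!*[p∸k]! : p ∣ (p C k) * (k ! * (p ∸ k) !)
    p∣pCk*k!*[p∸k]! = subst (p ∣_) (sym (nCk*k!*[n∸k]!≡n! (<⇒≤ k<p))) (n∣n! p)
  ... | inj₁ p∣pCk = p∣pCk
  ... | inj₂ p∣k!*[p∸k]! with euclidsLemma (k !) ((p ∸ k) !) p-prime p∣k!*[p∸k]!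
  ...   | inj₁ p∣k!     = contradiction p∣k! (p∤m! k k<p)
  ...   | inj₂ p∣[p∸k]! = contradiction p∣[p∸k]! (p∤m! (p ∸ k) (∸-monoʳ-< 0<k (<⇒≤ k<p)))

  ∣∸-cancelˡ : ∀ {x m n} → p ∤ x → n ≤ m → (x * m) % p ≡ (x * n) % p → p ∣ m ∸ n
  ∣∸-cancelˡ {x} {m} {n} p∤x n≤m xm≡xn
    with euclidsLemma x (m ∸ n) p-prime
           (subst (p ∣_) (sym (*-distribˡ-∸ x m n)) (%≡%⇒∣∸ (*-monoʳ-≤ x n≤m) xm≡xn))
  ... | inj₁ p∣x   = contradiction p∣x p∤x
  ... | inj₂ p∣m∸n = p∣m∸n

  *-cancelˡ-% : ∀ {x m n} → p ∤ x → (x * m) % p ≡ (x * n) % p → m % p ≡ n % p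
  *-cancelˡ-% {x} {m} {n} p∤x xm≡xn with ≤-total n m
  ... | inj₁ n≤m = ∣∸⇒%≡% n≤m (∣∸-cancelˡ p∤x n≤m xm≡xn)
  ... | inj₂ m≤n = sym (∣∸⇒%≡% m≤n (∣∸-cancelˡ p∤x m≤n (sym xm≡xn)))

  x^p%p≡x%p : ∀ x → x ^ p % p ≡ x % p
  x^p%p≡x%p zero    = cong (_% p) (0^n≡0 p)
    where
    0^n≡0 : ∀ n → .{{NonZero n}} → 0 ^ n ≡ 0
    0^n≡0 (suc n) = refl
  x^p%p≡x%p (suc x) = begin
    (1 + x) ^ p % p     ≡⟨ cong (λ z → z ^ p % p) (+-comm 1 x) ⟩
    (x + 1) ^ p % p     ≡⟨ [x+y]^n%d≡[x^n+y^n]%d p x 1 p∣pCk ⟩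
    (x ^ p + 1 ^ p) % p ≡⟨ %-cong-+ {p} {x ^ p} {x} {1 ^ p} {1} (x^p%p≡x%p x) (cong (_% p) (^-zeroˡ p)) ⟩
    (x + 1) % p         ≡⟨ cong (_% p) (+-comm x 1) ⟩
    suc x % p           ∎
    where open ≡-Reasoning

  x^[p∸1]%p≡1 : ∀ {x} → p ∤ x → x ^ (p ∸ 1) % p ≡ 1
  x^[p∸1]%p≡1 {x} p∤x = begin
    x ^ (p ∸ 1) % p ≡⟨ *-cancelˡ-% p∤x x*x^[p∸1]≡x*1 ⟩
    1 % p           ≡⟨ m<n⇒m%n≡m 1<p ⟩
    1               ∎
    where
    open ≡-Reasoning
    x*x^[p∸1]≡x*1 : (x * x ^ (p ∸ 1)) % p ≡ (x * 1) % p
    x*x^[p∸1]≡x*1 = begin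
      (x * x ^ (p ∸ 1)) % p ≡⟨ cong (λ k → x ^ k % p) (suc-pred p) ⟩
      x ^ p % p             ≡⟨ x^p%p≡x%p x ⟩
      x % p                 ≡⟨ cong (_% p) (*-identityʳ x) ⟨
      (x * 1) % p           ∎

module PrimeField {p : ℕ} (p-prime : Prime p) where
  open Fermat p-prime using (p-nonZero; 1<p; x^[p∸1]%p≡1)
  open Fp p

  toℕ-mod : ∀ m → toℕ (m mod p) ≡ m % p
  toℕ-mod m = toℕ-fromℕ< (m%n<n m p)

  toℕ-mod-% : ∀ m → toℕ (m mod p) % p ≡ m % p
  toℕ-mod-% m = trans (cong (_% p) (toℕ-mod m)) (m%n%n≡m%n m p)

  %≡%⇒mod≡mod : ∀ {m n} → m % p ≡ n % p → m mod p ≡ n mod p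
  %≡%⇒mod≡mod {m} {n} m≡n = toℕ-injective (trans (toℕ-mod m) (trans m≡n (sym (toℕ-mod n))))

  ·-comm : ∀ x y → x · y ≡ y · x
  ·-comm x y = cong (_mod p) (*-comm (toℕ x) (toℕ y))

  ·-assoc : ∀ x y z → (x · y) · z ≡ x · (y · z)
  ·-assoc x y z = %≡%⇒mod≡mod (begin
    (toℕ (x · y) * toℕ z) % p     ≡⟨ %-cong-* {p} (toℕ-mod-% (toℕ x * toℕ y)) refl ⟩
    (toℕ x * toℕ y * toℕ z) % p   ≡⟨ cong (_% p) (*-assoc (toℕ x) (toℕ y) (toℕ z)) ⟩
    (toℕ x * (toℕ y * toℕ z)) % p ≡⟨ %-cong-* {p} {m = toℕ x} refl (toℕ-mod-% (toℕ y * toℕ z)) ⟨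
    (toℕ x * toℕ (y · z)) % p     ∎)
    where open ≡-Reasoning

  one : F
  one = 1 mod p

  ·-identityʳ : ∀ x → x · one ≡ x
  ·-identityʳ x = toℕ-injective (begin
    toℕ (x · one)         ≡⟨ toℕ-mod (toℕ x * toℕ one) ⟩
    (toℕ x * toℕ one) % p ≡⟨ cong (λ k → (toℕ x * k) % p) (trans (toℕ-mod 1) (m<n⇒m%n≡m 1<p)) ⟩
    (toℕ x * 1) % p       ≡⟨ cong (_% p) (*-identityʳ (toℕ x)) ⟩
    toℕ x % p             ≡⟨ m<n⇒m%n≡m (toℕ<n x) ⟩
    toℕ x                 ∎)
    where open ≡-Reasoning

  ·-inverseʳ : ∀ {x} → NonZeroF x → x · inv x ≡ one
  ·-inverseʳ {x} x≢0 = %≡%⇒mod≡mod (begin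
    (toℕ x * toℕ (inv x)) % p     ≡⟨ %-cong-* {p} {m = toℕ x} refl (toℕ-mod-% (toℕ x ^ (p ∸ 2))) ⟩
    (toℕ x * toℕ x ^ (p ∸ 2)) % p ≡⟨ cong (λ k → toℕ x ^ k % p) (sym (+-∸-assoc 1 1<p)) ⟩
    toℕ x ^ (p ∸ 1) % p           ≡⟨ x^[p∸1]%p≡1 (>⇒∤ {{≢-nonZero x≢0}} (toℕ<n x)) ⟩
    1                             ≡⟨ m<n⇒m%n≡m 1<p ⟨
    1 % p                         ∎)
    where open ≡-Reasoning

  toℕ-·-zeroˡ : ∀ {x} y → toℕ x ≡ 0 → toℕ (x · y) ≡ 0
  toℕ-·-zeroˡ {x} y x≡0 =
    trans (toℕ-mod (toℕ x * toℕ y)) (trans (cong (λ k → (k * toℕ y) % p) x≡0) (m<n⇒m%n≡m (>-nonZero⁻¹ p)))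

  ·-isCommutativeMonoid : IsCommutativeMonoid _≡_ _·_ one
  ·-isCommutativeMonoid = record
    { isMonoid = record
      { isSemigroup = record { isMagma = isMagma _·_ ; assoc = ·-assoc }
      ; identity    = (λ x → trans (·-comm one x) (·-identityʳ x)) , ·-identityʳ
      }
    ; comm = ·-comm
    }

  ·-commutativeMonoid : CommutativeMonoid 0ℓ 0ℓ
  ·-commutativeMonoid = record { isCommutativeMonoid = ·-isCommutativeMonoid }

  open import Algebra.Solver.CommutativeMonoid ·-commutativeMonoid using (solve; _⊜_; _⊕_)

  ÷-·-cancel : ∀ {y} → NonZeroF y → ∀ x → (x ÷ y) · y ≡ x
  ÷-·-cancel {y} y≢0 x = begin
    (x · inv y) · y ≡⟨ solve 3 (λ x y y⁻¹ → (x ⊕ y⁻¹) ⊕ y ⊜ x ⊕ (y ⊕ y⁻¹)) refl x y (inv y) ⟩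
    x · (y · inv y) ≡⟨ cong (x ·_) (·-inverseʳ y≢0) ⟩
    x · one         ≡⟨ ·-identityʳ x ⟩
    x               ∎
    where open ≡-Reasoning

  ÷-·-÷ : ∀ {y} → NonZeroF y → ∀ x z → (x ÷ y) · (y ÷ z) ≡ x ÷ z
  ÷-·-÷ {y} y≢0 x z = begin
    (x · inv y) · (y · inv z) ≡⟨ solve 4 (λ x y y⁻¹ z⁻¹ → (x ⊕ y⁻¹) ⊕ (y ⊕ z⁻¹) ⊜ (x ⊕ z⁻¹) ⊕ (y ⊕ y⁻¹))
                                         refl x y (inv y) (inv z) ⟩
    (x · inv z) · (y · inv y) ≡⟨ cong ((x · inv z) ·_) (·-inverseʳ y≢0) ⟩
    (x · inv z) · one         ≡⟨ ·-identityʳ (x · inv z) ⟩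
    x · inv z                 ∎
    where open ≡-Reasoning

  ÷-≡-flip : ∀ {x y x′ y′} → NonZeroF x → NonZeroF y → NonZeroF x′ → NonZeroF y′ →
             x ÷ y ≡ x′ ÷ y′ → y ÷ x ≡ y′ ÷ x′
  ÷-≡-flip {x} {y} {x′} {y′} x≢0 y≢0 x′≢0 y′≢0 eq = begin
    y ÷ x                             ≡⟨ ·-identityʳ (y ÷ x) ⟨
    (y ÷ x) · one                     ≡⟨ cong ((y ÷ x) ·_) (trans (÷-·-÷ y′≢0 x′ x′) (·-inverseʳ x′≢0)) ⟨
    (y ÷ x) · ((x′ ÷ y′) · (y′ ÷ x′)) ≡⟨ cong (λ r → (y ÷ x) · (r · (y′ ÷ x′))) eq ⟨
    (y ÷ x) · ((x ÷ y) · (y′ ÷ x′))   ≡⟨ ·-assoc (y ÷ x) (x ÷ y) (y′ ÷ x′) ⟨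
    ((y ÷ x) · (x ÷ y)) · (y′ ÷ x′)   ≡⟨ cong (_· (y′ ÷ x′)) (trans (÷-·-÷ x≢0 y y) (·-inverseʳ y≢0)) ⟩
    one · (y′ ÷ x′)                   ≡⟨ trans (·-comm one _) (·-identityʳ (y′ ÷ x′)) ⟩
    y′ ÷ x′                           ∎
    where open ≡-Reasoning

  ÷-≡⇒Proportional : ∀ {a b c a′ b′ c′} → NonZeroF a → NonZeroF a′ →
                     b ÷ a ≡ b′ ÷ a′ → c ÷ a ≡ c′ ÷ a′ → Proportional (a , b , c) (a′ , b′ , c′)
  ÷-≡⇒Proportional {a} {b} {c} {a′} {b′} {c′} a≢0 a′≢0 b÷a≡ c÷a≡ =
    a′ ÷ a , l≢0 , sym (÷-·-cancel a≢0 a′) , scaled b÷a≡ , scaled c÷a≡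
    where
    scaled : ∀ {x x′} → x ÷ a ≡ x′ ÷ a′ → x′ ≡ (a′ ÷ a) · x
    scaled {x} {x′} eq = begin
      x′               ≡⟨ ÷-·-cancel a′≢0 x′ ⟨
      (x′ ÷ a′) · a′   ≡⟨ cong (_· a′) eq ⟨
      (x · inv a) · a′ ≡⟨ solve 3 (λ x a⁻¹ a′ → (x ⊕ a⁻¹) ⊕ a′ ⊜ (a′ ⊕ a⁻¹) ⊕ x) refl x (inv a) a′ ⟩
      (a′ · inv a) · x ∎
      where open ≡-Reasoning
    l≢0 : NonZeroF (a′ ÷ a)
    l≢0 l≡0 = a′≢0 (trans (cong toℕ (sym (÷-·-cancel a≢0 a′))) (toℕ-·-zeroˡ a l≡0))

  NonZero³ : F × F × F → Set
  NonZero³ (a , b , c) = NonZeroF a × NonZeroF b × NonZeroF c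

  shared-ratio⇒distinct-ratios : ∀ {a b c a′ b′ c′} → NonZero³ (a , b , c) → NonZero³ (a′ , b′ , c′) →
                                 ¬ Proportional (a , b , c) (a′ , b′ , c′) → b ÷ a ≡ b′ ÷ a′ →
                                 (a ÷ c ≢ a′ ÷ c′) × (b ÷ c ≢ b′ ÷ c′)
  shared-ratio⇒distinct-ratios {a} {b} {c} {a′} {b′} {c′} (a≢0 , b≢0 , c≢0) (a′≢0 , b′≢0 , c′≢0) ¬prop b÷a≡ =
    (λ a÷c≡ → ¬prop (÷-≡⇒Proportional a≢0 a′≢0 b÷a≡ (÷-≡-flip a≢0 c≢0 a′≢0 c′≢0 a÷c≡))) ,
    (λ b÷c≡ → ¬prop (÷-≡⇒Proportional a≢0 a′≢0 b÷a≡ (c÷a≡ b÷c≡)))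
    where
    c÷a≡ : b ÷ c ≡ b′ ÷ c′ → c ÷ a ≡ c′ ÷ a′
    c÷a≡ b÷c≡ = begin
      c ÷ a                 ≡⟨ ÷-·-÷ b≢0 c a ⟨
      (c ÷ b) · (b ÷ a)     ≡⟨ cong₂ _·_ (÷-≡-flip b≢0 c≢0 b′≢0 c′≢0 b÷c≡) b÷a≡ ⟩
      (c′ ÷ b′) · (b′ ÷ a′) ≡⟨ ÷-·-÷ b′≢0 c′ a′ ⟩
      c′ ÷ a′               ∎
      where open ≡-Reasoning
module _ {A : Set} where

  length-filter-+ : ∀ {P : Pred A 0ℓ} (P? : Decidable P) xs →
                    length (filter P? xs) + length (filter (¬? ∘ P?) xs) ≡ length xs
  length-filter-+ P? [] = refl
  length-filter-+ P? (x ∷ xs) with P? x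
  ... | yes _ = cong suc (length-filter-+ P? xs)
  ... | no  _ = trans (+-suc _ _) (cong suc (length-filter-+ P? xs))

  length-filter-< : ∀ {P : Pred A 0ℓ} (P? : Decidable P) {x xs} → x ∈ xs → ¬ P x →
                    length (filter P? xs) < length xs
  length-filter-< P? {xs = xs} x∈xs ¬Px = filter-notAll P? xs (lose x∈xs ¬Px)

  any-filter⁺ : ∀ {P Q : Pred A 0ℓ} (Q? : Decidable Q) {xs} → Any P xs → (∀ {x} → P x → Q x) →
                Any P (filter Q? xs)
  any-filter⁺ Q? p P⇒Q with find p
  ... | x , x∈xs , px = lose (∈-filter⁺ Q? x∈xs (P⇒Q px)) px

  AllPairs-∈ : ∀ {R : Rel A 0ℓ} → Symmetric R → ∀ {xs x y} → AllPairs R xs → x ∈ xs → y ∈ xs → x ≢ y → R x y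
  AllPairs-∈ sym (rx ∷ rxs) (here refl) (here refl) x≢y = contradiction refl x≢y
  AllPairs-∈ sym (rx ∷ rxs) (here refl) (there y∈) x≢y = All.lookup rx y∈
  AllPairs-∈ sym (rx ∷ rxs) (there x∈) (here refl) x≢y = sym (All.lookup rx x∈)
  AllPairs-∈ sym (rx ∷ rxs) (there x∈) (there y∈) x≢y = AllPairs-∈ sym rxs x∈ y∈ x≢y

module _ {I V : Set} {R : I → V → Set} (R? : ∀ e v → Dec (R e v)) where

  fibre : List I → V → List I
  fibre xs v = filter (λ e → R? e v) xs

  double-counting : ∀ {D} xs vs → (∀ {e} → e ∈ xs → Any (R e) vs) →
                    (∀ {v} → v ∈ vs → length (fibre xs v) ≤ D) → length xs ≤ length vs * D
  double-counting []       []       _      _     = z≤n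
  double-counting (e ∷ xs) []       covers _     with () ← covers (here refl)
  double-counting {D} xs   (c ∷ vs) covers small = begin
    length xs                         ≡⟨ length-filter-+ (λ e → R? e c) xs ⟨
    length (fibre xs c) + length rest ≤⟨ +-mono-≤ (small (here refl)) (double-counting rest vs covers-rest small-rest) ⟩
    D + length vs * D                 ∎
    where
    open ≤-Reasoning
    rest : List I
    rest = filter (λ e → ¬? (R? e c)) xs
    covers-rest : ∀ {e} → e ∈ rest → Any (R e) vs
    covers-rest e∈rest with ∈-filter⁻ (λ e → ¬? (R? e c)) {xs = xs} e∈rest
    ... | e∈xs , ¬Rec with covers e∈xs
    ...   | here Rec   = contradiction Rec ¬Rec
    ...   | there Rev  = Rev
    small-rest : ∀ {v} → v ∈ vs → length (fibre rest v) ≤ D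
    small-rest {v} v∈vs = ≤-trans
      (Sublist.length-mono-≤ (Sublist.filter⁺ _ _ (λ { refl Rev → Rev }) (Sublist.filter-⊆ (λ e → ¬? (R? e c)) xs)))
      (small (there v∈vs))

module Kőnig {I A B : Set} (_≟I_ : DecidableEquality I) (_≟A_ : DecidableEquality A) (_≟B_ : DecidableEquality B) where
  open import Data.List.Membership.DecPropositional _≟I_ using () renaming (_∈?_ to _∈I?_)

  Vertex : Set
  Vertex = A ⊎ B

  _≟V_ : DecidableEquality Vertex
  _≟V_ = ≡-dec _≟A_ _≟B_

  open import Data.List.Membership.DecPropositional _≟V_ using () renaming (_∈?_ to _∈V?_)

  record Graph : Set where
    field
      left  : I → A
      right : I → B

    Incident : I → Vertex → Set
    Incident e (inj₁ a) = left e ≡ a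
    Incident e (inj₂ b) = right e ≡ b

    incident? : ∀ e c → Dec (Incident e c)
    incident? e (inj₁ a) = left e ≟A a
    incident? e (inj₂ b) = right e ≟B b

    Disjoint : I → I → Set
    Disjoint e e′ = left e ≢ left e′ × right e ≢ right e′

  open Graph

  record Certificate (G : Graph) (xs : List I) : Set where
    field
      matching           : List I
      cover              : List Vertex
      disjoint           : AllPairs (Disjoint G) matching
      matching⊆edges     : matching ⊆ xs
      covers             : ∀ {e} → e ∈ xs → Any (Incident G e) cover
      ∣cover∣≤∣matching∣ : length cover ≤ length matching

  disjoint⇒¬common-end : ∀ {G e e′} c → Disjoint G e e′ → Incident G e c → ¬ Incident G e′ c
  disjoint⇒¬common-end (inj₁ a) (left≢ , _) ea e′a = left≢ (trans ea (sym e′a))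
  disjoint⇒¬common-end (inj₂ b) (_ , right≢) eb e′b = right≢ (trans eb (sym e′b))

  disjoint-sym : ∀ {G e e′} → Disjoint G e e′ → Disjoint G e′ e
  disjoint-sym (left≢ , right≢) = (λ eq → left≢ (sym eq)) , (λ eq → right≢ (sym eq))

  ∣matching∣≤∣cover∣ : ∀ G {M vs} → AllPairs (Disjoint G) M → (∀ {e} → e ∈ M → Any (Incident G e) vs) →
                       length M ≤ length vs
  ∣matching∣≤∣cover∣ G {[]}         _                 _      = z≤n
  ∣matching∣≤∣cover∣ G {e ∷ M} {vs} (e-disj ∷ M-disj) covers with find (covers (here refl))
  ... | c , c∈vs , e~c = ≤-trans (s≤s (∣matching∣≤∣cover∣ G M-disj covers-rest))
                                 (length-filter-< (λ c′ → ¬? (c′ ≟V c)) c∈vs (λ c≢c → c≢c refl))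
    where
    covers-rest : ∀ {e′} → e′ ∈ M → Any (Incident G e′) (filter (λ c′ → ¬? (c′ ≟V c)) vs)
    covers-rest e′∈M = any-filter⁺ (λ c′ → ¬? (c′ ≟V c)) (covers (there e′∈M))
      (λ { e′~c refl → disjoint⇒¬common-end c (All.lookup e-disj e′∈M) e~c e′~c })

  Shorter : List I → Set
  Shorter xs = ∀ G ys → length ys < length xs → Certificate G ys

  -- Rizzi's induction.  Let u, v be the ends of x and K₁ a certificate for G − v.  If no edge of K₁ meets
  -- u, add x to the matching and v to the cover.  Otherwise either another edge y at u lies outside K₁
  -- (Exchange), or u has exactly the two edges x and y ∈ K₁ (Contraction).
  module Step (G : Graph) {xs : List I} (ih : Shorter xs) {x : I} (x∈xs : x ∈ xs) where
    u : A
    u = left G x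

    v : B
    v = right G x

    off-v? : ∀ e → Dec (right G e ≢ v)
    off-v? e = ¬? (right G e ≟B v)

    K₁ : Certificate G (filter off-v? xs)
    K₁ = ih G _ (length-filter-< off-v? x∈xs (λ x≁v → x≁v refl))

    module K₁ = Certificate K₁

    K₁-off-v : ∀ {e} → e ∈ K₁.matching → e ∈ xs × right G e ≢ v
    K₁-off-v e∈M₁ = ∈-filter⁻ off-v? {xs = xs} (K₁.matching⊆edges e∈M₁)

    covers-with-v : ∀ {e} → e ∈ xs → Any (Incident G e) (inj₂ v ∷ K₁.cover)
    covers-with-v {e} e∈xs with right G e ≟B v
    ... | yes e~v = here e~v
    ... | no  e≁v = there (K₁.covers (∈-filter⁺ off-v? e∈xs e≁v))

    spare? : ∀ e → Dec (left G e ≡ u × e ≢ x × e ∉ K₁.matching)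
    spare? e = (left G e ≟A u) ×-dec (¬? (e ≟I x) ×-dec ¬? (e ∈I? K₁.matching))

    add-x : ¬ Any (λ e → left G e ≡ u) K₁.matching → Certificate G xs
    add-x none-at-u = record
      { matching           = x ∷ K₁.matching
      ; cover              = inj₂ v ∷ K₁.cover
      ; disjoint           = All.tabulate x-disjoint ∷ K₁.disjoint
      ; matching⊆edges     = λ { (here refl) → x∈xs ; (there e∈M₁) → proj₁ (K₁-off-v e∈M₁) }
      ; covers             = covers-with-v
      ; ∣cover∣≤∣matching∣ = s≤s K₁.∣cover∣≤∣matching∣
      }
      where
      x-disjoint : ∀ {e} → e ∈ K₁.matching → Disjoint G x e
      x-disjoint e∈M₁ = (λ u≡ → none-at-u (lose e∈M₁ (sym u≡))) , (λ v≡ → proj₂ (K₁-off-v e∈M₁) (sym v≡))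

    module Exchange {y : I} (y∈xs : y ∈ xs) (y~u : left G y ≡ u) (y≢x : y ≢ x) (y∉M₁ : y ∉ K₁.matching) where
      off-y? : ∀ e → Dec (e ≢ y)
      off-y? e = ¬? (e ≟I y)

      K₂ : Certificate G (filter off-y? xs)
      K₂ = ih G _ (length-filter-< off-y? y∈xs (λ y≢y → y≢y refl))

      module K₂ = Certificate K₂

      K₂-edges : K₂.matching ⊆ xs
      K₂-edges e∈M₂ = proj₁ (∈-filter⁻ off-y? {xs = xs} (K₂.matching⊆edges e∈M₂))

      -- K₁ avoids v and y, so it must be covered by C₂ without v; this is why C₂ reaches x, hence y, through u.
      v∉C₂ : length K₂.matching ≤ length K₁.matching → inj₂ v ∉ K₂.cover
      v∉C₂ M₂≤M₁ v∈C₂ = <-irrefl refl (begin-strict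
        length K₁.matching   ≤⟨ ∣matching∣≤∣cover∣ G K₁.disjoint covers-M₁ ⟩
        length C₂-v          <⟨ length-filter-< (λ c → ¬? (c ≟V inj₂ v)) v∈C₂ (λ v≢v → v≢v refl) ⟩
        length K₂.cover      ≤⟨ K₂.∣cover∣≤∣matching∣ ⟩
        length K₂.matching   ≤⟨ M₂≤M₁ ⟩
        length K₁.matching   ∎)
        where
        open ≤-Reasoning
        C₂-v : List Vertex
        C₂-v = filter (λ c → ¬? (c ≟V inj₂ v)) K₂.cover
        covers-M₁ : ∀ {e} → e ∈ K₁.matching → Any (Incident G e) C₂-v
        covers-M₁ e∈M₁ = any-filter⁺ (λ c → ¬? (c ≟V inj₂ v))
          (K₂.covers (∈-filter⁺ off-y? (proj₁ (K₁-off-v e∈M₁)) (λ { refl → y∉M₁ e∈M₁ })))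
          (λ { e~v refl → proj₂ (K₁-off-v e∈M₁) e~v })

      K₂-covers : length K₂.matching ≤ length K₁.matching → ∀ {e} → e ∈ xs → Any (Incident G e) K₂.cover
      K₂-covers M₂≤M₁ {e} e∈xs with e ≟I y
      ... | no  e≢y = K₂.covers (∈-filter⁺ off-y? e∈xs e≢y)
      ... | yes refl with find (K₂.covers (∈-filter⁺ off-y? x∈xs (λ x≡y → y≢x (sym x≡y))))
      ...   | inj₁ a , a∈C₂ , x~a  = lose a∈C₂ (trans y~u x~a)
      ...   | inj₂ b , b∈C₂ , refl = contradiction b∈C₂ (v∉C₂ M₂≤M₁)

      certificate : Certificate G xs
      certificate with length K₁.matching <? length K₂.matching
      ... | yes M₁<M₂ = record
        { matching           = K₂.matching
        ; cover              = inj₂ v ∷ K₁.cover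
        ; disjoint           = K₂.disjoint
        ; matching⊆edges     = K₂-edges
        ; covers             = covers-with-v
        ; ∣cover∣≤∣matching∣ = ≤-trans (s≤s K₁.∣cover∣≤∣matching∣) M₁<M₂
        }
      ... | no  M₁≮M₂ = record
        { matching           = K₂.matching
        ; cover              = K₂.cover
        ; disjoint           = K₂.disjoint
        ; matching⊆edges     = K₂-edges
        ; covers             = K₂-covers (≮⇒≥ M₁≮M₂)
        ; ∣cover∣≤∣matching∣ = K₂.∣cover∣≤∣matching∣
        }

    -- Delete u and identify w with v; a certificate for the contracted graph extends by one edge at u.
    module Contraction {y : I} (y∈M₁ : y ∈ K₁.matching) (y~u : left G y ≡ u)
                       (only-x-y : ∀ {e} → e ∈ xs → left G e ≡ u → e ≡ x ⊎ e ≡ y) where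
      w : B
      w = right G y

      y∈xs : y ∈ xs
      y∈xs = proj₁ (K₁-off-v y∈M₁)

      w≢v : w ≢ v
      w≢v = proj₂ (K₁-off-v y∈M₁)

      merge : B → B
      merge b with b ≟B w
      ... | yes _ = v
      ... | no  _ = b

      merge-w : merge w ≡ v
      merge-w with w ≟B w
      ... | yes _   = refl
      ... | no  w≢w = contradiction refl w≢w

      merge-≢ : ∀ {b} → b ≢ w → merge b ≡ b
      merge-≢ {b} b≢w with b ≟B w
      ... | yes b≡w = contradiction b≡w b≢w
      ... | no  _   = refl

      G′ : Graph
      G′ = record { left = left G ; right = merge ∘ right G }

      off-u? : ∀ e → Dec (left G e ≢ u)
      off-u? e = ¬? (left G e ≟A u)

      K′ : Certificate G′ (filter off-u? xs)
      K′ = ih G′ _ (length-filter-< off-u? x∈xs (λ x≁u → x≁u refl))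

      module K′ = Certificate K′

      K′-off-u : ∀ {e} → e ∈ K′.matching → e ∈ xs × left G e ≢ u
      K′-off-u e∈M′ = ∈-filter⁻ off-u? {xs = xs} (K′.matching⊆edges e∈M′)

      K′-covers : ∀ {e} → e ∈ xs → left G e ≢ u →
                  Any (Incident G e) K′.cover ⊎ (right G e ≡ w × inj₂ v ∈ K′.cover)
      K′-covers {e} e∈xs e≁u with find (K′.covers (∈-filter⁺ off-u? e∈xs e≁u))
      ... | inj₁ a , a∈C′ , e~a = inj₁ (lose a∈C′ e~a)
      ... | inj₂ b , b∈C′ , e~b = unmerge (right G e ≟B w) e~b b∈C′
        where
        unmerge : ∀ {b} → Dec (right G e ≡ w) → merge (right G e) ≡ b → inj₂ b ∈ K′.cover →
                  Any (Incident G e) K′.cover ⊎ (right G e ≡ w × inj₂ v ∈ K′.cover)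
        unmerge (yes e~w) e~b b∈C′ =
          inj₂ (e~w , subst (λ b → inj₂ b ∈ K′.cover) (trans (sym e~b) (trans (cong merge e~w) merge-w)) b∈C′)
        unmerge (no e≁w) e~b b∈C′ = inj₁ (lose b∈C′ (trans (sym (merge-≢ e≁w)) e~b))

      x-disjoint : Any (λ e → right G e ≡ w) K′.matching → ∀ {e} → e ∈ K′.matching → Disjoint G x e
      x-disjoint at-w {e} e∈M′ with find at-w
      ... | e* , e*∈M′ , e*~w = (λ u≡ → proj₂ (K′-off-u e∈M′) (sym u≡)) , right≢
        where
        right≢ : v ≢ right G e
        right≢ v≡ with e ≟I e*
        ... | yes refl = w≢v (trans (sym e*~w) (sym v≡))
        ... | no  e≢e* = proj₂ (AllPairs-∈ (disjoint-sym {G′}) K′.disjoint e∈M′ e*∈M′ e≢e*) (begin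
          merge (right G e)  ≡⟨ cong merge v≡ ⟨
          merge v            ≡⟨ merge-≢ (λ v≡w → w≢v (sym v≡w)) ⟩
          v                  ≡⟨ merge-w ⟨
          merge w            ≡⟨ cong merge e*~w ⟨
          merge (right G e*) ∎)
          where open ≡-Reasoning

      y-disjoint : ¬ Any (λ e → right G e ≡ w) K′.matching → ∀ {e} → e ∈ K′.matching → Disjoint G y e
      y-disjoint none-at-w e∈M′ =
        (λ u≡ → proj₂ (K′-off-u e∈M′) (trans (sym u≡) y~u)) , (λ w≡ → none-at-w (lose e∈M′ (sym w≡)))

      covers-with-w : inj₂ v ∈ K′.cover → ∀ {e} → e ∈ xs → Any (Incident G e) (inj₂ w ∷ K′.cover)
      covers-with-w v∈C′ {e} e∈xs with left G e ≟A u
      ... | yes e~u with only-x-y e∈xs e~u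
      ...   | inj₁ refl = there (lose v∈C′ refl)
      ...   | inj₂ refl = here refl
      covers-with-w v∈C′ {e} e∈xs | no e≁u with K′-covers e∈xs e≁u
      ...   | inj₁ covered   = there covered
      ...   | inj₂ (e~w , _) = here e~w

      covers-with-u : inj₂ v ∉ K′.cover → ∀ {e} → e ∈ xs → Any (Incident G e) (inj₁ u ∷ K′.cover)
      covers-with-u v∉C′ {e} e∈xs with left G e ≟A u
      ... | yes e~u = here e~u
      ... | no  e≁u with K′-covers e∈xs e≁u
      ...   | inj₁ covered    = there covered
      ...   | inj₂ (_ , v∈C′) = contradiction v∈C′ v∉C′

      extend : ∀ {h} c → h ∈ xs → (∀ {e} → e ∈ K′.matching → Disjoint G h e) →
               (∀ {e} → e ∈ xs → Any (Incident G e) (c ∷ K′.cover)) → Certificate G xs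
      extend {h} c h∈xs h-disjoint covers = record
        { matching           = h ∷ K′.matching
        ; cover              = c ∷ K′.cover
        ; disjoint           = All.tabulate h-disjoint ∷ AllPairs.map (λ (l≢ , r≢) → l≢ , r≢ ∘ cong merge) K′.disjoint
        ; matching⊆edges     = λ { (here refl) → h∈xs ; (there e∈M′) → proj₁ (K′-off-u e∈M′) }
        ; covers             = covers
        ; ∣cover∣≤∣matching∣ = s≤s K′.∣cover∣≤∣matching∣
        }

      certificate : Certificate G xs
      certificate with any? (λ e → right G e ≟B w) K′.matching | inj₂ v ∈V? K′.cover
      ... | yes at-w    | yes v∈C′ = extend (inj₂ w) x∈xs (x-disjoint at-w) (covers-with-w v∈C′)
      ... | yes at-w    | no  v∉C′ = extend (inj₁ u) x∈xs (x-disjoint at-w) (covers-with-u v∉C′)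
      ... | no none-at-w | yes v∈C′ = extend (inj₂ w) y∈xs (y-disjoint none-at-w) (covers-with-w v∈C′)
      ... | no none-at-w | no  v∉C′ = extend (inj₁ u) y∈xs (y-disjoint none-at-w) (covers-with-u v∉C′)

    certificate : Certificate G xs
    certificate with any? (λ e → left G e ≟A u) K₁.matching
    ... | no none-at-u = add-x none-at-u
    ... | yes at-u with find at-u
    ...   | y , y∈M₁ , y~u with any? spare? xs
    ...     | yes spare with find spare
    ...       | z , z∈xs , (z~u , z≢x , z∉M₁) = Exchange.certificate z∈xs z~u z≢x z∉M₁
    certificate | yes at-u | y , y∈M₁ , y~u | no no-spare = Contraction.certificate y∈M₁ y~u only-x-y
      where
      only-x-y : ∀ {e} → e ∈ xs → left G e ≡ u → e ≡ x ⊎ e ≡ y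
      only-x-y {e} e∈xs e~u with e ≟I x | e ∈I? K₁.matching | e ≟I y
      ... | yes e≡x | _        | _        = inj₁ e≡x
      ... | no  e≢x | no e∉M₁  | _        = contradiction (lose e∈xs (e~u , e≢x , e∉M₁)) no-spare
      ... | no  _   | yes _    | yes e≡y  = inj₂ e≡y
      ... | no  _   | yes e∈M₁ | no  e≢y  =
        contradiction (trans e~u (sym y~u)) (proj₁ (AllPairs-∈ (disjoint-sym {G}) K₁.disjoint e∈M₁ y∈M₁ e≢y))

  kőnig : ∀ G xs → Certificate G xs
  kőnig G xs = bounded (length xs) G xs ≤-refl
    where
    bounded : ∀ n G xs → length xs ≤ n → Certificate G xs
    bounded _       G []       _ = record
      { matching = [] ; cover = [] ; disjoint = [] ; matching⊆edges = λ ()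
      ; covers = λ () ; ∣cover∣≤∣matching∣ = z≤n }
    bounded (suc n) G (x ∷ xs) (s≤s ∣xs∣≤n) =
      Step.certificate G (λ G′ ys ys<x∷xs → bounded n G′ ys (≤-trans (≤-pred ys<x∷xs) ∣xs∣≤n)) (here refl)

module _ {n : ℕ} where

  fromList : List (Fin n) → Subset n
  fromList []       = ⊥
  fromList (i ∷ is) = ⁅ i ⁆ ∪ fromList is

  ∈-fromList⁻ : ∀ {i is} → i ∈ₛ fromList is → i ∈ is
  ∈-fromList⁻ {is = []}     i∈⊥ = contradiction i∈⊥ ∉⊥
  ∈-fromList⁻ {is = j ∷ is} i∈  with x∈p∪q⁻ ⁅ j ⁆ (fromList is) i∈
  ... | inj₁ i∈⁅j⁆ = here (x∈⁅y⁆⇒x≡y j i∈⁅j⁆)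
  ... | inj₂ i∈is  = there (∈-fromList⁻ i∈is)

  length≤∣fromList∣ : ∀ {is} → Unique is → length is ≤ ∣ fromList is ∣
  length≤∣fromList∣ {[]}     []             = z≤n
  length≤∣fromList∣ {i ∷ is} (i∉is ∷ uniq) =
    ≤-trans (s≤s (length≤∣fromList∣ uniq))
            (p⊂q⇒∣p∣<∣q∣ (q⊆p∪q ⁅ i ⁆ (fromList is) , i , x∈p∪q⁺ (inj₁ (x∈⁅x⁆ i)) , i∉))
    where
    i∉ : ¬ i ∈ₛ fromList is
    i∉ i∈ = All.lookup i∉is (∈-fromList⁻ i∈) refl


module Transversals {p : ℕ} .{{_ : NonZero p}} (p-prime : Prime p) {n : ℕ} (E : Fp.Family p n) (adm : Fp.Admissible p E) where
  open Fp p
  open PrimeField p-prime using (one; NonZero³; shared-ratio⇒distinct-ratios)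
  open Family E
  open Admissible adm
  open Kőnig (Data.Fin._≟_ {n}) (Data.Fin._≟_ {p}) (Data.Fin._≟_ {p})
  open Graph

  Separates : Fin 3 → Fin n → Fin n → Set
  Separates k i j = (proj₁ (project k (triple i)) ≢ proj₁ (project k (triple j))) ×
                    (proj₂ (project k (triple i)) ≢ proj₂ (project k (triple j)))

  fromList-transversal : ∀ k {is} → (∀ {i j} → i ∈ is → j ∈ is → i ≢ j → Separates k i j) →
                         IsTransversal E k (fromList is)
  fromList-transversal k separates i j i∈ j∈ = separates (∈-fromList⁻ i∈) (∈-fromList⁻ j∈)

  G : Graph
  G = record { left = λ j → b j ÷ a j ; right = λ j → c j ÷ a j }

  module K = Certificate (kőnig G (allFin n))

  ν : ℕ
  ν = length K.matching

  matching-transversal : IsTransversal E fzero (fromList K.matching)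
  matching-transversal = fromList-transversal fzero (AllPairs-∈ (disjoint-sym {G}) K.disjoint)

  ν≤∣matching∣ : ν ≤ ∣ fromList K.matching ∣
  ν≤∣matching∣ = length≤∣fromList∣ (AllPairs.map (λ disj i≡j → proj₁ disj (cong (left G) i≡j)) K.disjoint)

  fibre-direction : Vertex → Fin 3
  fibre-direction (inj₁ _) = fsuc (fsuc fzero)
  fibre-direction (inj₂ _) = fsuc fzero

  fibre-separates : ∀ v {i j} → Incident G i v → Incident G j v → i ≢ j → Separates (fibre-direction v) i j
  fibre-separates (inj₁ _) {i} {j} i~v j~v i≢j =
    shared-ratio⇒distinct-ratios (a-nz i , b-nz i , c-nz i) (a-nz j , b-nz j , c-nz j)
      (nonprop i j i≢j) (trans i~v (sym j~v))
  fibre-separates (inj₂ _) {i} {j} i~v j~v i≢j =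
    shared-ratio⇒distinct-ratios (a-nz i , c-nz i , b-nz i) (a-nz j , c-nz j , b-nz j)
      (λ (l , l≢0 , a≡ , c≡ , b≡) → nonprop i j i≢j (l , l≢0 , a≡ , b≡ , c≡)) (trans i~v (sym j~v))

  fibreOf : Vertex → List (Fin n)
  fibreOf = fibre (incident? G) (allFin n)

  fibre-transversal : ∀ v → IsTransversal E (fibre-direction v) (fromList (fibreOf v))
  fibre-transversal v = fromList-transversal (fibre-direction v) λ i∈ j∈ → fibre-separates v (in-fibre i∈) (in-fibre j∈)
    where
    in-fibre : ∀ {i} → i ∈ fibreOf v → Incident G i v
    in-fibre = proj₂ ∘ ∈-filter⁻ (λ e → incident? G e v) {xs = allFin n}

  -- The default vertex need not lie in the cover: its fibre is a transversal all the same.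
  busiest : Vertex
  busiest = argmax (length ∘ fibreOf) (inj₁ one) K.cover

  Δ : ℕ
  Δ = length (fibreOf busiest)

  Δ≤∣fibre∣ : Δ ≤ ∣ fromList (fibreOf busiest) ∣
  Δ≤∣fibre∣ = length≤∣fromList∣ (Unique.filter⁺ (λ e → incident? G e busiest) (Unique.allFin⁺ n))

  n≤ν*Δ : n ≤ ν * Δ
  n≤ν*Δ = begin
    n                  ≡⟨ length-tabulate id ⟨
    length (allFin n)  ≤⟨ double-counting (incident? G) (allFin n) K.cover K.covers
                            (All.lookup (f[xs]≤f[argmax] (inj₁ one) K.cover)) ⟩
    length K.cover * Δ ≤⟨ *-monoˡ-≤ Δ K.∣cover∣≤∣matching∣ ⟩
    ν * Δ              ∎
    where open ≤-Reasoning

lemma3 : (p : ℕ) .{{_ : NonZero p}} → Prime p → (n : ℕ) → (E : Fp.Family p n) → Fp.Admissible p E →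
    ∃[ k ] ∃[ J ] (Fp.IsTransversal p E k J × n ≤ ∣ J ∣ * ∣ J ∣)
lemma3 p p-prime n E adm = choose (Δ ≤? ν)
  where
  open Transversals p-prime E adm
  open ≤-Reasoning
  choose : Dec (Δ ≤ ν) → ∃[ k ] ∃[ J ] (Fp.IsTransversal p E k J × n ≤ ∣ J ∣ * ∣ J ∣)
  choose (yes Δ≤ν) = fzero , fromList K.matching , matching-transversal , (begin
    n                                                 ≤⟨ n≤ν*Δ ⟩
    ν * Δ                                             ≤⟨ *-monoʳ-≤ ν Δ≤ν ⟩
    ν * ν                                             ≤⟨ *-mono-≤ ν≤∣matching∣ ν≤∣matching∣ ⟩
    ∣ fromList K.matching ∣ * ∣ fromList K.matching ∣ ∎)
  choose (no Δ≰ν) = fibre-direction busiest , fromList (fibreOf busiest) , fibre-transversal busiest , (begin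
    n                                                                 ≤⟨ n≤ν*Δ ⟩
    ν * Δ                                                             ≤⟨ *-monoˡ-≤ Δ (<⇒≤ (≰⇒> Δ≰ν)) ⟩
    Δ * Δ                                                             ≤⟨ *-mono-≤ Δ≤∣fibre∣ Δ≤∣fibre∣ ⟩
    ∣ fromList (fibreOf busiest) ∣ * ∣ fromList (fibreOf busiest) ∣ ∎)
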